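{- Let $a,b$ be positive integers and let $h^{a,b}_n$ be the number of tilings of the honeycomb strip $H_n$ by monomers, each colored with one of $a$ colors, and dimers, each colored with one of $b$ colors. Then for $n\ge 4$, $$h^{a,b}_n=a\,h^{a,b}_{n-1}+b\,h^{a,b}_{n-2}+ab\,h^{a,b}_{n-3}+b^2\,h^{a,b}_{n-4},$$ with initial conditions $h^{a,b}_0=1$, $h^{a,b}_1=a$, $h^{a,b}_2=a^2+b$, $h^{a,b}_3=a^3+3ab$.
   Context: The honeycomb strip $H_n$ consists of $n$ regular hexagons arranged in two rows, numbered $1,\dots,n$ from the bottom left so that odd-numbered hexagons form the bottom row and even-numbered ones the top row; hexagon $i$ shares an edge with hexagons $i\pm1$ and $i\pm2$ (when they exist), and with no others. A monomer is a single hexagon; a dimer is a pair of edge-adjacent hexagons, i.e. either $\{i,i+1\}$ (slanted) or $\{i,i+2\}$ (horizontal). A tiling of $H_n$ is a partition of its hexagons into monomers and dimers; colored tilings are counted as distinct if the tilings or the color assignments differ. -}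

module Defs where

open import Data.Nat using (ℕ; zero; suc; _+_; _*_; _^_)
open import Data.Fin using (Fin; toℕ)
open import Data.Vec using (Vec; lookup; allFin)
open import Data.Vec.Relation.Unary.All using (All)
open import Data.Sum using (_⊎_; inj₁; inj₂)
open import Data.Product using (Σ; _×_; _,_)
open import Relation.Binary.PropositionalEquality using (_≡_)

-- Hexagons of H_n are indexed by Fin n : index i stands for hexagon i+1.
-- Hexagon i shares an edge exactly with hexagons i±1 and i±2.
EdgeAdjacent : {n : ℕ} → Fin n → Fin n → Set
EdgeAdjacent i j =
  (toℕ j ≡ suc (toℕ i)) ⊎ (toℕ j ≡ suc (suc (toℕ i))) ⊎
  (toℕ i ≡ suc (toℕ j)) ⊎ (toℕ i ≡ suc (suc (toℕ j)))

IsMonomerColour : {a b : ℕ} → Fin a ⊎ Fin b → Set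
IsMonomerColour {a} {b} x = Σ (Fin a) λ k → x ≡ inj₁ k

IsDimerColour : {a b : ℕ} → Fin a ⊎ Fin b → Set
IsDimerColour {a} {b} x = Σ (Fin b) λ k → x ≡ inj₂ k

-- A tiling of H_n is encoded by its partner vector p : hexagon i lies in
-- the tile {i , p i} (a monomer iff p i ≡ i, otherwise the dimer {i , p i},
-- which must be edge-adjacent, with p (p i) ≡ i).  A colouring assigns to
-- each hexagon the colour of the tile containing it (so both hexagons of a
-- dimer carry the same dimer colour).
CellOK : {a b n : ℕ} → Vec (Fin n) n → Vec (Fin a ⊎ Fin b) n → Fin n → Set
CellOK {a} {b} p c i =
  (lookup p i ≡ i × IsMonomerColour {a} {b} (lookup c i))
  ⊎ (EdgeAdjacent i (lookup p i) × lookup p (lookup p i) ≡ i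
     × IsDimerColour {a} {b} (lookup c i) × lookup c (lookup p i) ≡ lookup c i)

ColoredTiling : ℕ → ℕ → ℕ → Set
ColoredTiling a b n =
  Σ (Vec (Fin n) n × Vec (Fin a ⊎ Fin b) n) λ where
    (p , c) → All (CellOK {a} {b} p c) (allFin n)

hrec : ℕ → ℕ → ℕ → ℕ
hrec a b 0 = 1
hrec a b 1 = a
hrec a b 2 = a ^ 2 + b
hrec a b 3 = a ^ 3 + 3 * a * b
hrec a b (suc (suc (suc (suc n)))) =
  a * hrec a b (suc (suc (suc n))) + b * hrec a b (suc (suc n))
  + a * b * hrec a b (suc n) + b ^ 2 * hrec a b n

-- Hexagon 1 lies in a monomer, in the slanted dimer {1,2} or in the horizontal dimer {1,3}.
-- In the last case hexagon 2, whose neighbours 1 and 3 are taken, is a monomer or lies in the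
-- horizontal dimer {2,4}.  So a colored tiling is one of four blocks, colored in a, b, ab or b²
-- ways, followed by a colored tiling of the strip shortened by 1, 2, 3 or 4 hexagons: this is
-- the recurrence, and the initial values are the same decomposition with the blocks that do not
-- fit left out.  Decoding partner vectors block by block turns this into a bijection with
-- sequences of blocks, which are then counted.
module Submission where

open import Defs
open import Axiom.UniquenessOfIdentityProofs using (module Decidable⇒UIP)
open import Data.Empty using (⊥-elim)
open import Data.Fin using (Fin; zero; suc; toℕ; _↑ʳ_; reduce≥; fromℕ<)
open import Data.Fin.Properties using (toℕ-↑ʳ; ↑ʳ-injective; +↔⊎; *↔×; _≟_)
open import Data.Fin.Patterns using (0F; 1F; 2F; 3F)
open import Data.Nat using (ℕ; zero; suc; _+_; _*_; _^_; _≤_; _<_; z<s; s<s; s≤s⁻¹)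
open import Data.Nat.Properties
  using (m≢1+n+m; +-cancelˡ-≡; ≮⇒≥; <⇒≱; m≤m+n; *-identityʳ)
import Data.Nat.Properties as ℕ
open import Algebra.Properties.CommutativeSemigroup ℕ.+-commutativeSemigroup using (x∙yz≈y∙xz)
open import Data.Nat.Tactic.RingSolver using (solve-∀)
open import Data.Product using (_×_; _,_)
open import Data.Product.Function.NonDependent.Propositional using (_×-↔_)
open import Data.Sum using (_⊎_; inj₁; inj₂)
open import Data.Sum.Function.Propositional using (_⊎-⇔_; _⊎-↔_)
open import Data.Sum.Properties using (≡-dec)
open import Data.Vec using (Vec; []; _∷_; _++_; lookup; map; allFin)
open import Data.Vec.Properties using (lookup-map; lookup-++ʳ; lookup-++-<)
open import Data.Vec.Relation.Unary.All using (All; []; _∷_)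
import Data.Vec.Relation.Unary.All as All
open import Data.Vec.Relation.Unary.All.Properties using (tabulate⁺; tabulate⁻; lookup⁺)
open import Function using (_∘_)
open import Function.Bundles using (_⇔_; mk⇔; _↔_; mk↔ₛ′; Equivalence)
open import Function.Properties.Inverse using (↔-refl; ↔-sym; ↔-trans)
open import Relation.Binary.PropositionalEquality using (_≡_; refl; sym; trans; cong; cong₂; subst)
open import Relation.Nullary using (¬_)
open import Relation.Nullary.Irrelevant using (Irrelevant)

⊎-irrelevant : ∀ {A B : Set} → Irrelevant A → Irrelevant B → (A → ¬ B) → Irrelevant (A ⊎ B)
⊎-irrelevant irrA _ _ (inj₁ x) (inj₁ y) = cong inj₁ (irrA x y)
⊎-irrelevant _ _ disjoint (inj₁ x) (inj₂ y) = ⊥-elim (disjoint x y)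
⊎-irrelevant _ _ disjoint (inj₂ x) (inj₁ y) = ⊥-elim (disjoint y x)
⊎-irrelevant _ irrB _ (inj₂ x) (inj₂ y) = cong inj₂ (irrB x y)

×-irrelevant : ∀ {A B : Set} → Irrelevant A → Irrelevant B → Irrelevant (A × B)
×-irrelevant irrA irrB (x , y) (x′ , y′) = cong₂ _,_ (irrA x x′) (irrB y y′)

Fin-cong : ∀ {m n} → m ≡ n → Fin m ↔ Fin n
Fin-cong refl = ↔-refl

+↔⊎-cong : ∀ {m n} {A B : Set} → Fin m ↔ A → Fin n ↔ B → Fin (m + n) ↔ (A ⊎ B)
+↔⊎-cong f g = ↔-trans +↔⊎ (f ⊎-↔ g)

*↔×-cong : ∀ {m n} {A B : Set} → Fin m ↔ A → Fin n ↔ B → Fin (m * n) ↔ (A × B)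
*↔×-cong f g = ↔-trans *↔× (f ×-↔ g)

^2↔× : ∀ {m} → Fin (m ^ 2) ↔ (Fin m × Fin m)
^2↔× {m} = *↔×-cong ↔-refl (Fin-cong (*-identityʳ m))

adjacent-irrefl : ∀ {n} (i : Fin n) → ¬ EdgeAdjacent i i
adjacent-irrefl i (inj₁ e) = m≢1+n+m (toℕ i) {0} e
adjacent-irrefl i (inj₂ (inj₁ e)) = m≢1+n+m (toℕ i) {1} e
adjacent-irrefl i (inj₂ (inj₂ (inj₁ e))) = m≢1+n+m (toℕ i) {0} e
adjacent-irrefl i (inj₂ (inj₂ (inj₂ e))) = m≢1+n+m (toℕ i) {1} e

adjacent-irrelevant : ∀ {n} {i j : Fin n} → Irrelevant (EdgeAdjacent i j)
adjacent-irrelevant {i = i} {j} =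
  ⊎-irrelevant ℕ.≡-irrelevant
    (⊎-irrelevant ℕ.≡-irrelevant
      (⊎-irrelevant ℕ.≡-irrelevant ℕ.≡-irrelevant
        λ e e′ → m≢1+n+m (toℕ j) {0} (ℕ.suc-injective (trans (sym e) e′)))
      λ { e (inj₁ e′) → m≢1+n+m (toℕ i) {2} (trans e′ (cong (1 +_) e))
        ; e (inj₂ e′) → m≢1+n+m (toℕ i) {3} (trans e′ (cong (2 +_) e)) })
    λ { e (inj₁ e′) → m≢1+n+m (toℕ i) {0} (ℕ.suc-injective (trans (sym e) e′))
      ; e (inj₂ (inj₁ e′)) → m≢1+n+m (toℕ i) {1} (trans e′ (cong (1 +_) e))
      ; e (inj₂ (inj₂ e′)) → m≢1+n+m (toℕ i) {2} (trans e′ (cong (2 +_) e)) }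

↑ʳ-offset : ∀ k {m} d (i j : Fin m) → (toℕ (k ↑ʳ j) ≡ d + toℕ (k ↑ʳ i)) ⇔ (toℕ j ≡ d + toℕ i)
↑ʳ-offset k d i j rewrite toℕ-↑ʳ k i | toℕ-↑ʳ k j = mk⇔
  (λ e → +-cancelˡ-≡ k _ _ (trans e (x∙yz≈y∙xz d k (toℕ i))))
  (λ e → trans (cong (k +_) e) (x∙yz≈y∙xz k d (toℕ i)))

adjacent-↑ʳ : ∀ k {m} {i j : Fin m} → EdgeAdjacent (k ↑ʳ i) (k ↑ʳ j) ⇔ EdgeAdjacent i j
adjacent-↑ʳ k {i = i} {j} =
  ↑ʳ-offset k 1 i j ⊎-⇔ ↑ʳ-offset k 2 i j ⊎-⇔ ↑ʳ-offset k 1 j i ⊎-⇔ ↑ʳ-offset k 2 j i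

↑ʳ-reduce≥ : ∀ k {m} (x : Fin (k + m)) .(k≤x : k ≤ toℕ x) → k ↑ʳ reduce≥ x k≤x ≡ x
↑ʳ-reduce≥ zero x _ = refl
↑ʳ-reduce≥ (suc k) (suc x) k≤x = cong suc (↑ʳ-reduce≥ k x (s≤s⁻¹ k≤x))

reduce≥-↑ʳ : ∀ k {m} (y : Fin m) .(k≤y : k ≤ toℕ (k ↑ʳ y)) → reduce≥ (k ↑ʳ y) k≤y ≡ y
reduce≥-↑ʳ zero y _ = refl
reduce≥-↑ʳ (suc k) y k≤y = reduce≥-↑ʳ k y (s≤s⁻¹ k≤y)

lower : ∀ k {m l} (xs : Vec (Fin (k + m)) l) → .(∀ j → k ≤ toℕ (lookup xs j)) → Vec (Fin m) l
lower k [] _ = []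
lower k (x ∷ xs) k≤ = reduce≥ x (k≤ zero) ∷ lower k xs (k≤ ∘ suc)

↑ʳ-lookup-lower : ∀ k {m l} (xs : Vec (Fin (k + m)) l) .(k≤ : ∀ j → k ≤ toℕ (lookup xs j)) j →
                  k ↑ʳ lookup (lower k xs k≤) j ≡ lookup xs j
↑ʳ-lookup-lower k (x ∷ xs) k≤ zero = ↑ʳ-reduce≥ k x (k≤ zero)
↑ʳ-lookup-lower k (x ∷ xs) k≤ (suc j) = ↑ʳ-lookup-lower k xs (k≤ ∘ suc) j

map-↑ʳ-lower : ∀ k {m l} (xs : Vec (Fin (k + m)) l) .(k≤ : ∀ j → k ≤ toℕ (lookup xs j)) →
               map (k ↑ʳ_) (lower k xs k≤) ≡ xs
map-↑ʳ-lower k [] _ = refl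
map-↑ʳ-lower k (x ∷ xs) k≤ = cong₂ _∷_ (↑ʳ-reduce≥ k x (k≤ zero)) (map-↑ʳ-lower k xs (k≤ ∘ suc))

lower-map-↑ʳ : ∀ k {m l} (ys : Vec (Fin m) l) .(k≤ : ∀ j → k ≤ toℕ (lookup (map (k ↑ʳ_) ys) j)) →
               lower k (map (k ↑ʳ_) ys) k≤ ≡ ys
lower-map-↑ʳ k [] _ = refl
lower-map-↑ʳ k (y ∷ ys) k≤ = cong₂ _∷_ (reduce≥-↑ʳ k y (k≤ zero)) (lower-map-↑ʳ k ys (k≤ ∘ suc))

hrec-2 : ∀ a b → hrec a b 2 ≡ a * hrec a b 1 + b * hrec a b 0
hrec-2 = identity
  where
  identity : ∀ a b → a * (a * 1) + b ≡ a * a + b * 1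
  identity = solve-∀

hrec-3 : ∀ a b → hrec a b 3 ≡ a * hrec a b 2 + b * hrec a b 1 + a * b * hrec a b 0
hrec-3 = identity
  where
  identity : ∀ a b → a * (a * (a * 1)) + 3 * a * b ≡ a * (a * (a * 1) + b) + b * a + a * b * 1
  identity = solve-∀

module _ (a b : ℕ) where

  Colour : Set
  Colour = Fin a ⊎ Fin b

  -- A record rather than the bare All, so that p and c can be inferred from a proof.
  record IsColoredTiling {n} (p : Vec (Fin n) n) (c : Vec Colour n) : Set where
    constructor mkIsColoredTiling
    field allCells : All (CellOK {a} {b} p c) (allFin n)
  open IsColoredTiling

  cellAt : ∀ {n} {p : Vec (Fin n) n} {c} → IsColoredTiling p c → ∀ i → CellOK {a} {b} p c i
  cellAt v = tabulate⁻ (allCells v)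

  monomerColour-irrelevant : ∀ {x} → Irrelevant (IsMonomerColour {a} {b} x)
  monomerColour-irrelevant (j , refl) (.j , refl) = refl

  dimerColour-irrelevant : ∀ {x} → Irrelevant (IsDimerColour {a} {b} x)
  dimerColour-irrelevant (k , refl) (.k , refl) = refl

  cellOK-irrelevant : ∀ {n} {p : Vec (Fin n) n} {c} {i} → Irrelevant (CellOK {a} {b} p c i)
  cellOK-irrelevant {p = p} {c} {i} =
    ⊎-irrelevant (×-irrelevant Fin-uip monomerColour-irrelevant)
      (×-irrelevant (adjacent-irrelevant {i = i} {lookup p i})
        (×-irrelevant Fin-uip (×-irrelevant dimerColour-irrelevant Colour-uip)))
      λ { (_ , (_ , mono)) (_ , _ , (_ , dim) , _) → inj₁≢inj₂ (trans (sym mono) dim) }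
    where
    Fin-uip : ∀ {n} {x y : Fin n} → Irrelevant (x ≡ y)
    Fin-uip = Decidable⇒UIP.≡-irrelevant _≟_
    Colour-uip : {x y : Colour} → Irrelevant (x ≡ y)
    Colour-uip = Decidable⇒UIP.≡-irrelevant (≡-dec _≟_ _≟_)
    inj₁≢inj₂ : ∀ {j : Fin a} {l : Fin b} → ¬ (inj₁ j ≡ inj₂ l)
    inj₁≢inj₂ ()

  isColoredTiling-irrelevant : ∀ {n} {p : Vec (Fin n) n} {c} → Irrelevant (IsColoredTiling p c)
  isColoredTiling-irrelevant {p = p} {c} (mkIsColoredTiling v) (mkIsColoredTiling v′) =
    cong mkIsColoredTiling (All.irrelevant (cellOK-irrelevant {p = p} {c}) v v′)

  partner-involutive : ∀ {n} {p : Vec (Fin n) n} {c} {i} →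
                       CellOK {a} {b} p c i → lookup p (lookup p i) ≡ i
  partner-involutive {p = p} (inj₁ (fixed , _)) = trans (cong (lookup p) fixed) fixed
  partner-involutive (inj₂ (_ , invol , _)) = invol

  module _ (k : ℕ) {m} (p : Vec (Fin (k + m)) (k + m)) (c : Vec Colour (k + m))
           (q : Vec (Fin m) m) (d : Vec Colour m)
           (p-↑ʳ : ∀ i → lookup p (k ↑ʳ i) ≡ k ↑ʳ lookup q i)
           (c-↑ʳ : ∀ i → lookup c (k ↑ʳ i) ≡ lookup d i) where

    cellOK-↑ʳ⁺ : ∀ {i} → CellOK {a} {b} q d i → CellOK {a} {b} p c (k ↑ʳ i)
    cellOK-↑ʳ⁺ {i} (inj₁ (fixed , j , mono)) =
      inj₁ (trans (p-↑ʳ i) (cong (k ↑ʳ_) fixed) , j , trans (c-↑ʳ i) mono)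
    cellOK-↑ʳ⁺ {i} (inj₂ (adj , invol , (l , dim) , same)) =
      inj₂ ( subst (EdgeAdjacent (k ↑ʳ i)) (sym (p-↑ʳ i)) (Equivalence.from (adjacent-↑ʳ k) adj)
           , trans (cong (lookup p) (p-↑ʳ i)) (trans (p-↑ʳ (lookup q i)) (cong (k ↑ʳ_) invol))
           , (l , trans (c-↑ʳ i) dim)
           , trans (cong (lookup c) (p-↑ʳ i))
               (trans (c-↑ʳ (lookup q i)) (trans same (sym (c-↑ʳ i)))) )

    cellOK-↑ʳ⁻ : ∀ {i} → CellOK {a} {b} p c (k ↑ʳ i) → CellOK {a} {b} q d i
    cellOK-↑ʳ⁻ {i} (inj₁ (fixed , j , mono)) =
      inj₁ (↑ʳ-injective k _ _ (trans (sym (p-↑ʳ i)) fixed) , j , trans (sym (c-↑ʳ i)) mono)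
    cellOK-↑ʳ⁻ {i} (inj₂ (adj , invol , (l , dim) , same)) =
      inj₂ ( Equivalence.to (adjacent-↑ʳ k) (subst (EdgeAdjacent (k ↑ʳ i)) (p-↑ʳ i) adj)
           , ↑ʳ-injective k _ _
               (trans (sym (p-↑ʳ (lookup q i))) (trans (sym (cong (lookup p) (p-↑ʳ i))) invol))
           , (l , trans (sym (c-↑ʳ i)) dim)
           , trans (sym (c-↑ʳ (lookup q i)))
               (trans (sym (cong (lookup c) (p-↑ʳ i))) (trans same (c-↑ʳ i))) )

  -- The leftmost block: horizontal-monomer is the dimer {1,3} with the monomer 2, and
  -- horizontal-pair the dimers {1,3} and {2,4}.
  data Tiling : ℕ → Set where
    empty : Tiling 0
    monomer : ∀ {n} → Fin a → Tiling n → Tiling (1 + n)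
    slanted : ∀ {n} → Fin b → Tiling n → Tiling (2 + n)
    horizontal-monomer : ∀ {n} → Fin a → Fin b → Tiling n → Tiling (3 + n)
    horizontal-pair : ∀ {n} → Fin b → Fin b → Tiling n → Tiling (4 + n)

  partners : ∀ {n} → Tiling n → Vec (Fin n) n
  partners empty = []
  partners (monomer _ t) = 0F ∷ map (1 ↑ʳ_) (partners t)
  partners (slanted _ t) = 1F ∷ 0F ∷ map (2 ↑ʳ_) (partners t)
  partners (horizontal-monomer _ _ t) = 2F ∷ 1F ∷ 0F ∷ map (3 ↑ʳ_) (partners t)
  partners (horizontal-pair _ _ t) = 2F ∷ 3F ∷ 0F ∷ 1F ∷ map (4 ↑ʳ_) (partners t)

  colours : ∀ {n} → Tiling n → Vec Colour n
  colours empty = []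
  colours (monomer j t) = inj₁ j ∷ colours t
  colours (slanted k t) = inj₂ k ∷ inj₂ k ∷ colours t
  colours (horizontal-monomer j k t) = inj₂ k ∷ inj₁ j ∷ inj₂ k ∷ colours t
  colours (horizontal-pair k l t) = inj₂ k ∷ inj₂ l ∷ inj₂ k ∷ inj₂ l ∷ colours t

  partners-cell-↑ʳ : ∀ k {m} (pre : Vec (Fin (k + m)) k) (cpre : Vec Colour k) (t : Tiling m) i →
                     CellOK {a} {b} (pre ++ map (k ↑ʳ_) (partners t)) (cpre ++ colours t) (k ↑ʳ i)

  partners-cell : ∀ {n} (t : Tiling n) i → CellOK {a} {b} (partners t) (colours t) i
  partners-cell (monomer j t) 0F = inj₁ (refl , (j , refl))
  partners-cell (monomer j t) (suc i) =
    partners-cell-↑ʳ 1 (0F ∷ []) (inj₁ j ∷ []) t i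
  partners-cell (slanted k t) 0F = inj₂ (inj₁ refl , refl , (k , refl) , refl)
  partners-cell (slanted k t) 1F = inj₂ (inj₂ (inj₂ (inj₁ refl)) , refl , (k , refl) , refl)
  partners-cell (slanted k t) (suc (suc i)) =
    partners-cell-↑ʳ 2 (1F ∷ 0F ∷ []) (inj₂ k ∷ inj₂ k ∷ []) t i
  partners-cell (horizontal-monomer j k t) 0F = inj₂ (inj₂ (inj₁ refl) , refl , (k , refl) , refl)
  partners-cell (horizontal-monomer j k t) 1F = inj₁ (refl , (j , refl))
  partners-cell (horizontal-monomer j k t) 2F = inj₂ (inj₂ (inj₂ (inj₂ refl)) , refl , (k , refl) , refl)
  partners-cell (horizontal-monomer j k t) (suc (suc (suc i))) =
    partners-cell-↑ʳ 3 (2F ∷ 1F ∷ 0F ∷ []) (inj₂ k ∷ inj₁ j ∷ inj₂ k ∷ []) t i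
  partners-cell (horizontal-pair k l t) 0F = inj₂ (inj₂ (inj₁ refl) , refl , (k , refl) , refl)
  partners-cell (horizontal-pair k l t) 1F = inj₂ (inj₂ (inj₁ refl) , refl , (l , refl) , refl)
  partners-cell (horizontal-pair k l t) 2F = inj₂ (inj₂ (inj₂ (inj₂ refl)) , refl , (k , refl) , refl)
  partners-cell (horizontal-pair k l t) 3F = inj₂ (inj₂ (inj₂ (inj₂ refl)) , refl , (l , refl) , refl)
  partners-cell (horizontal-pair k l t) (suc (suc (suc (suc i)))) =
    partners-cell-↑ʳ 4 (2F ∷ 3F ∷ 0F ∷ 1F ∷ []) (inj₂ k ∷ inj₂ l ∷ inj₂ k ∷ inj₂ l ∷ []) t i

  partners-cell-↑ʳ k pre cpre t i =
    cellOK-↑ʳ⁺ k (pre ++ map (k ↑ʳ_) (partners t)) (cpre ++ colours t) (partners t) (colours t)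
      (λ j → trans (lookup-++ʳ pre _ j) (lookup-map j (k ↑ʳ_) (partners t)))
      (lookup-++ʳ cpre (colours t)) (partners-cell t i)

  partners-valid : ∀ {n} (t : Tiling n) → IsColoredTiling (partners t) (colours t)
  partners-valid t = mkIsColoredTiling (tabulate⁺ (partners-cell t))

  module Restriction {k m} (pre : Vec (Fin (k + m)) k) (cpre : Vec Colour k)
                     {xs : Vec (Fin (k + m)) m} {cs : Vec Colour m}
                     (closed : All (λ x → toℕ x < k) pre)
                     (valid : IsColoredTiling (pre ++ xs) (cpre ++ cs)) where

    private
      cell : ∀ i → CellOK {a} {b} (pre ++ xs) (cpre ++ cs) i
      cell = cellAt valid

    -- If the partner of a tail cell lay in the block, so would its partner, the tail cell itself.
    tail-partner-≥ : ∀ j → k ≤ toℕ (lookup xs j)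
    tail-partner-≥ j = ≮⇒≥ λ x<k → <⇒≱ (block-partner x<k) k≤k↑ʳj
      where
      x = lookup xs j
      k≤k↑ʳj : k ≤ toℕ (k ↑ʳ j)
      k≤k↑ʳj = subst (k ≤_) (sym (toℕ-↑ʳ k j)) (m≤m+n k (toℕ j))
      partner-x : lookup (pre ++ xs) x ≡ k ↑ʳ j
      partner-x = trans (cong (lookup (pre ++ xs)) (sym (lookup-++ʳ pre xs j)))
                        (partner-involutive {p = pre ++ xs} {cpre ++ cs} (cell (k ↑ʳ j)))
      block-partner : toℕ x < k → toℕ (k ↑ʳ j) < k
      block-partner x<k = subst (λ y → toℕ y < k)
        (trans (sym (lookup-++-< pre xs x x<k)) partner-x) (lookup⁺ closed (fromℕ< x<k))

    rest : Vec (Fin m) m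
    rest = lower k xs tail-partner-≥

    rest-valid : IsColoredTiling rest cs
    rest-valid = mkIsColoredTiling (tabulate⁺ λ i → cellOK-↑ʳ⁻ k (pre ++ xs) (cpre ++ cs) rest cs
      (λ j → trans (lookup-++ʳ pre xs j) (sym (↑ʳ-lookup-lower k xs tail-partner-≥ j)))
      (lookup-++ʳ cpre cs) (cell (k ↑ʳ i)))

  data FirstBlock : ∀ {n} → Vec (Fin n) n → Vec Colour n → Set where
    monomer : ∀ {m} (j : Fin a) {xs : Vec (Fin (1 + m)) m} {cs} →
              FirstBlock (0F ∷ xs) (inj₁ j ∷ cs)
    slanted : ∀ {m} (k : Fin b) {xs : Vec (Fin (2 + m)) m} {cs} →
              FirstBlock (1F ∷ 0F ∷ xs) (inj₂ k ∷ inj₂ k ∷ cs)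
    horizontal-monomer : ∀ {m} (j : Fin a) (k : Fin b) {xs : Vec (Fin (3 + m)) m} {cs} →
              FirstBlock (2F ∷ 1F ∷ 0F ∷ xs) (inj₂ k ∷ inj₁ j ∷ inj₂ k ∷ cs)
    horizontal-pair : ∀ {m} (k l : Fin b) {xs : Vec (Fin (4 + m)) m} {cs} →
              FirstBlock (2F ∷ 3F ∷ 0F ∷ 1F ∷ xs) (inj₂ k ∷ inj₂ l ∷ inj₂ k ∷ inj₂ l ∷ cs)

  horizontalBlock : ∀ {m} {y : Fin (3 + m)} {xs : Vec (Fin (3 + m)) m} {k c₁ cs} →
                    CellOK {a} {b} (2F ∷ y ∷ 0F ∷ xs) (inj₂ k ∷ c₁ ∷ inj₂ k ∷ cs) 1F →
                    FirstBlock (2F ∷ y ∷ 0F ∷ xs) (inj₂ k ∷ c₁ ∷ inj₂ k ∷ cs)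
  horizontalBlock {k = k} (inj₁ (refl , (j , refl))) = horizontal-monomer j k
  horizontalBlock {y = 0F} (inj₂ (_ , () , _))
  horizontalBlock {m} {y = 1F} (inj₂ (adj , _)) = ⊥-elim (adjacent-irrefl {3 + m} 1F adj)
  horizontalBlock {y = 2F} (inj₂ (_ , () , _))
  horizontalBlock {y = 3F} {_ ∷ _} {k} {cs = _ ∷ _} (inj₂ (_ , refl , (l , refl) , refl)) =
    horizontal-pair k l
  horizontalBlock {y = suc (suc (suc (suc _)))} (inj₂ (inj₁ () , _))
  horizontalBlock {y = suc (suc (suc (suc _)))} (inj₂ (inj₂ (inj₁ ()) , _))
  horizontalBlock {y = suc (suc (suc (suc _)))} (inj₂ (inj₂ (inj₂ (inj₁ ())) , _))
  horizontalBlock {y = suc (suc (suc (suc _)))} (inj₂ (inj₂ (inj₂ (inj₂ ())) , _))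

  firstBlock : ∀ {m} {p : Vec (Fin (suc m)) (suc m)} {c} →
               IsColoredTiling p c → FirstBlock p c
  firstBlock {m} {p = 0F ∷ _} {_ ∷ _} v with cellAt v 0F
  ... | inj₁ (_ , (j , refl)) = monomer j
  ... | inj₂ (adj , _) = ⊥-elim (adjacent-irrefl {suc m} 0F adj)
  firstBlock {p = 1F ∷ _ ∷ _} {_ ∷ _ ∷ _} v with cellAt v 0F
  ... | inj₁ (() , _)
  ... | inj₂ (_ , refl , (k , refl) , refl) = slanted k
  firstBlock {p = 2F ∷ _ ∷ _ ∷ _} {_ ∷ _ ∷ _ ∷ _} v with cellAt v 0F
  ... | inj₁ (() , _)
  ... | inj₂ (_ , refl , (k , refl) , refl) = horizontalBlock (cellAt v 1F)
  firstBlock {p = suc (suc (suc _)) ∷ _} v with cellAt v 0F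
  ... | inj₁ (() , _)
  ... | inj₂ (inj₁ () , _)
  ... | inj₂ (inj₂ (inj₁ ()) , _)
  ... | inj₂ (inj₂ (inj₂ (inj₁ ())) , _)
  ... | inj₂ (inj₂ (inj₂ (inj₂ ())) , _)

  decode : ∀ {n} {p : Vec (Fin n) n} {c} → IsColoredTiling p c → Tiling n
  decode {zero} {[]} {[]} _ = empty
  decode {suc _} v with firstBlock v
  ... | monomer j = monomer j (decode (Restriction.rest-valid
    (0F ∷ []) (inj₁ j ∷ []) (z<s ∷ []) v))
  ... | slanted k = slanted k (decode (Restriction.rest-valid
    (1F ∷ 0F ∷ []) (inj₂ k ∷ inj₂ k ∷ []) (s<s z<s ∷ z<s ∷ []) v))
  ... | horizontal-monomer j k = horizontal-monomer j k (decode (Restriction.rest-valid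
    (2F ∷ 1F ∷ 0F ∷ []) (inj₂ k ∷ inj₁ j ∷ inj₂ k ∷ [])
    (s<s (s<s z<s) ∷ s<s z<s ∷ z<s ∷ []) v))
  ... | horizontal-pair k l = horizontal-pair k l (decode (Restriction.rest-valid
    (2F ∷ 3F ∷ 0F ∷ 1F ∷ []) (inj₂ k ∷ inj₂ l ∷ inj₂ k ∷ inj₂ l ∷ [])
    (s<s (s<s z<s) ∷ s<s (s<s (s<s z<s)) ∷ z<s ∷ s<s z<s ∷ []) v))

  decode-cong : ∀ {n} {p p′ : Vec (Fin n) n} {c} → p ≡ p′ →
                (v : IsColoredTiling p c) (v′ : IsColoredTiling p′ c) → decode v ≡ decode v′
  decode-cong refl v v′ = cong decode (isColoredTiling-irrelevant v v′)

  decode-partners : ∀ {n} (t : Tiling n) → decode (partners-valid t) ≡ t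
  decode-partners empty = refl
  decode-partners (monomer j t) =
    cong (monomer j) (trans (decode-cong (lower-map-↑ʳ 1 (partners t) _) _ _) (decode-partners t))
  decode-partners (slanted k t) =
    cong (slanted k) (trans (decode-cong (lower-map-↑ʳ 2 (partners t) _) _ _) (decode-partners t))
  decode-partners (horizontal-monomer j k t) = cong (horizontal-monomer j k)
    (trans (decode-cong (lower-map-↑ʳ 3 (partners t) _) _ _) (decode-partners t))
  decode-partners (horizontal-pair k l t) = cong (horizontal-pair k l)
    (trans (decode-cong (lower-map-↑ʳ 4 (partners t) _) _ _) (decode-partners t))

  partners-decode : ∀ {n} {p : Vec (Fin n) n} {c} (v : IsColoredTiling p c) → partners (decode v) ≡ p
  partners-decode {zero} {[]} {[]} _ = refl
  partners-decode {suc _} v with firstBlock v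
  ... | monomer j {xs} = cong (0F ∷_)
    (trans (cong (map (1 ↑ʳ_)) (partners-decode _)) (map-↑ʳ-lower 1 xs _))
  ... | slanted k {xs} = cong (λ ys → 1F ∷ 0F ∷ ys)
    (trans (cong (map (2 ↑ʳ_)) (partners-decode _)) (map-↑ʳ-lower 2 xs _))
  ... | horizontal-monomer j k {xs} = cong (λ ys → 2F ∷ 1F ∷ 0F ∷ ys)
    (trans (cong (map (3 ↑ʳ_)) (partners-decode _)) (map-↑ʳ-lower 3 xs _))
  ... | horizontal-pair k l {xs} = cong (λ ys → 2F ∷ 3F ∷ 0F ∷ 1F ∷ ys)
    (trans (cong (map (4 ↑ʳ_)) (partners-decode _)) (map-↑ʳ-lower 4 xs _))

  colours-decode : ∀ {n} {p : Vec (Fin n) n} {c} (v : IsColoredTiling p c) → colours (decode v) ≡ c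
  colours-decode {zero} {[]} {[]} _ = refl
  colours-decode {suc _} v with firstBlock v
  ... | monomer j = cong (inj₁ j ∷_) (colours-decode _)
  ... | slanted k = cong (λ cs → inj₂ k ∷ inj₂ k ∷ cs) (colours-decode _)
  ... | horizontal-monomer j k = cong (λ cs → inj₂ k ∷ inj₁ j ∷ inj₂ k ∷ cs) (colours-decode _)
  ... | horizontal-pair k l = cong (λ cs → inj₂ k ∷ inj₂ l ∷ inj₂ k ∷ inj₂ l ∷ cs) (colours-decode _)

  coloredTiling-≡ : ∀ {n} {p p′ : Vec (Fin n) n} {c c′ : Vec Colour n} → p ≡ p′ → c ≡ c′ →
                    (v : All (CellOK p c) (allFin n)) (v′ : All (CellOK p′ c′) (allFin n)) →
                    _≡_ {A = ColoredTiling a b n} ((p , c) , v) ((p′ , c′) , v′)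
  coloredTiling-≡ {p = p} {c = c} refl refl v v′ =
    cong ((p , c) ,_) (All.irrelevant (cellOK-irrelevant {p = p} {c}) v v′)

  coloredTiling↔tiling : ∀ n → ColoredTiling a b n ↔ Tiling n
  coloredTiling↔tiling n = mk↔ₛ′ (λ (_ , v) → decode (mkIsColoredTiling v)) encode
    decode-partners
    (λ (_ , v) → coloredTiling-≡ (partners-decode (mkIsColoredTiling v))
                                 (colours-decode (mkIsColoredTiling v)) _ v)
    where
    encode : Tiling n → ColoredTiling a b n
    encode t = (partners t , colours t) , allCells (partners-valid t)

  tiling₂↔ : Tiling 2 ↔ (Fin a × Tiling 1 ⊎ Fin b × Tiling 0)
  tiling₂↔ = mk↔ₛ′
    (λ { (monomer j t) → inj₁ (j , t) ; (slanted k t) → inj₂ (k , t) })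
    (λ { (inj₁ (j , t)) → monomer j t ; (inj₂ (k , t)) → slanted k t })
    (λ { (inj₁ _) → refl ; (inj₂ _) → refl })
    (λ { (monomer _ _) → refl ; (slanted _ _) → refl })

  tiling₃↔ : Tiling 3 ↔ ((Fin a × Tiling 2 ⊎ Fin b × Tiling 1) ⊎ (Fin a × Fin b) × Tiling 0)
  tiling₃↔ = mk↔ₛ′
    (λ { (monomer j t) → inj₁ (inj₁ (j , t)) ; (slanted k t) → inj₁ (inj₂ (k , t))
       ; (horizontal-monomer j k t) → inj₂ ((j , k) , t) })
    (λ { (inj₁ (inj₁ (j , t))) → monomer j t ; (inj₁ (inj₂ (k , t))) → slanted k t
       ; (inj₂ ((j , k) , t)) → horizontal-monomer j k t })
    (λ { (inj₁ (inj₁ _)) → refl ; (inj₁ (inj₂ _)) → refl ; (inj₂ _) → refl })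
    (λ { (monomer _ _) → refl ; (slanted _ _) → refl ; (horizontal-monomer _ _ _) → refl })

  tiling₄₊↔ : ∀ n → Tiling (4 + n) ↔
    (((Fin a × Tiling (3 + n) ⊎ Fin b × Tiling (2 + n)) ⊎ (Fin a × Fin b) × Tiling (1 + n))
     ⊎ (Fin b × Fin b) × Tiling n)
  tiling₄₊↔ n = mk↔ₛ′
    (λ { (monomer j t) → inj₁ (inj₁ (inj₁ (j , t))) ; (slanted k t) → inj₁ (inj₁ (inj₂ (k , t)))
       ; (horizontal-monomer j k t) → inj₁ (inj₂ ((j , k) , t))
       ; (horizontal-pair k l t) → inj₂ ((k , l) , t) })
    (λ { (inj₁ (inj₁ (inj₁ (j , t)))) → monomer j t ; (inj₁ (inj₁ (inj₂ (k , t)))) → slanted k t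
       ; (inj₁ (inj₂ ((j , k) , t))) → horizontal-monomer j k t
       ; (inj₂ ((k , l) , t)) → horizontal-pair k l t })
    (λ { (inj₁ (inj₁ (inj₁ _))) → refl ; (inj₁ (inj₁ (inj₂ _))) → refl
       ; (inj₁ (inj₂ _)) → refl ; (inj₂ _) → refl })
    (λ { (monomer _ _) → refl ; (slanted _ _) → refl
       ; (horizontal-monomer _ _ _) → refl ; (horizontal-pair _ _ _) → refl })

  hrec↔tiling : ∀ n → Fin (hrec a b n) ↔ Tiling n
  hrec↔tiling 0 = mk↔ₛ′ (λ _ → empty) (λ _ → 0F) (λ { empty → refl }) (λ { 0F → refl ; (suc ()) })
  hrec↔tiling 1 = mk↔ₛ′ (λ j → monomer j empty) (λ { (monomer j empty) → j })
    (λ { (monomer _ empty) → refl }) (λ _ → refl)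
  hrec↔tiling 2 = ↔-trans (Fin-cong (hrec-2 a b)) (↔-trans
    (+↔⊎-cong (*↔×-cong ↔-refl (hrec↔tiling 1)) (*↔×-cong ↔-refl (hrec↔tiling 0)))
    (↔-sym tiling₂↔))
  hrec↔tiling 3 = ↔-trans (Fin-cong (hrec-3 a b)) (↔-trans
    (+↔⊎-cong (+↔⊎-cong (*↔×-cong ↔-refl (hrec↔tiling 2)) (*↔×-cong ↔-refl (hrec↔tiling 1)))
              (*↔×-cong *↔× (hrec↔tiling 0)))
    (↔-sym tiling₃↔))
  hrec↔tiling (suc (suc (suc (suc n)))) = ↔-trans
    (+↔⊎-cong (+↔⊎-cong (+↔⊎-cong (*↔×-cong ↔-refl (hrec↔tiling (suc (suc (suc n)))))
                                   (*↔×-cong ↔-refl (hrec↔tiling (suc (suc n)))))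
                        (*↔×-cong *↔× (hrec↔tiling (suc n))))
              (*↔×-cong ^2↔× (hrec↔tiling n)))
    (↔-sym (tiling₄₊↔ n))

theorem3 : (a b : ℕ) → 0 < a → 0 < b → (n : ℕ) →
    ColoredTiling a b n ↔ Fin (hrec a b n)
theorem3 a b _ _ n = ↔-trans (coloredTiling↔tiling a b n) (↔-sym (hrec↔tiling a b n))
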